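{- Let $\mathbf u$ be a binary simple Parry sequence, i.e., $m=2$, with parameters $t_1,t_2$. Then: (1) for $n\in\{0,1\}$, every prefix of $\mathbf u$ of length $\ell\in[U_n,U_{n+1}-1]$ has the attractor $\Gamma_n$; (2) for each $n\in\mathbb N$, $n\ge2$, every prefix of $\mathbf u$ of length $\ell\in[U_n,Z_n]$ has the attractor $\Gamma_{n-1}$; (3) for each $n\in\mathbb N$, $n\ge2$, every prefix of $\mathbf u$ of length $\ell\in[Z_n,U_{n+1}]$ has the attractor $\Gamma_n$.
   Context: Binary simple Parry sequence: $t_1,t_2\in\mathbb N$ with $t_1\ge t_2\ge1$ (equivalently $t_20^\omega\prec_{\mathrm{lex}}t_1t_20^\omega$); $\varphi(0)=0^{t_1}1$, $\varphi(1)=0^{t_2}$; $\mathbf u$ is the fixed point of $\varphi$ starting with $0$. Let $u_n=\varphi^n(0)$, $U_n=|u_n|$ for $n\ge0$, and $u_n=\varepsilon$, $U_n=0$ for $n<0$. $\Gamma_0=\{U_0-1\}$, $\Gamma_1=\{U_0-1,U_1-1\}$, and $\Gamma_n=\{U_{n-1}-1,U_n-1\}$ for $n\ge2$. For $n\ge2$, $Z_n=|u_nu_{n-2}^{t_1-t_2}u_{n-3}^{t_2}|$. A (string) attractor of a finite word $w=w_0\cdots w_{N-1}$ is a set $\Gamma\subseteq\{0,\dots,N-1\}$ such that every non-empty factor of $w$ has an occurrence $w_i\cdots w_{j-1}$ with $\{i,\dots,j-1\}\cap\Gamma\ne\emptyset$; positions are indexed from $0$. -}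

module Defs where

open import Data.Nat using (ℕ; zero; suc; _+_; _*_; _∸_; _≤_; _<_)
open import Data.Fin using (Fin)
open import Data.List using (List; []; _∷_; _++_; [_]; replicate; concat; concatMap; length; take; drop; map; upTo)
open import Data.List.Membership.Propositional using (_∈_)
open import Data.List.Relation.Unary.All using (All)
open import Data.Product using (Σ; _×_; ∃-syntax)
open import Relation.Binary.PropositionalEquality using (_≡_)

Letter : Set
Letter = Fin 2

Word : Set
Word = List Letter

φ-letter : ℕ → ℕ → Letter → Word
φ-letter t₁ t₂ Fin.zero = replicate t₁ Fin.zero ++ [ Fin.suc Fin.zero ]
φ-letter t₁ t₂ (Fin.suc _) = replicate t₂ Fin.zero

φ : ℕ → ℕ → Word → Word
φ t₁ t₂ = concatMap (φ-letter t₁ t₂)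

uw : ℕ → ℕ → ℕ → Word
uw t₁ t₂ zero = [ Fin.zero ]
uw t₁ t₂ (suc n) = φ t₁ t₂ (uw t₁ t₂ n)

U : ℕ → ℕ → ℕ → ℕ
U t₁ t₂ n = length (uw t₁ t₂ n)

-- shifted: uw⁻ k = u_{k-1}, with u_{-1} = ε
uw⁻ : ℕ → ℕ → ℕ → Word
uw⁻ t₁ t₂ zero = []
uw⁻ t₁ t₂ (suc k) = uw t₁ t₂ k

-- Z_n = |u_n u_{n-2}^{t₁-t₂} u_{n-3}^{t₂}| for n ≥ 2 (value for n < 2 unused)
Z : ℕ → ℕ → ℕ → ℕ
Z t₁ t₂ zero = 0
Z t₁ t₂ (suc zero) = 0
Z t₁ t₂ (suc (suc m)) =
  length (uw t₁ t₂ (suc (suc m))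
          ++ concat (replicate (t₁ ∸ t₂) (uw t₁ t₂ m))
          ++ concat (replicate t₂ (uw⁻ t₁ t₂ m)))

-- i-th letter of a word, with a default for out-of-range indices
at : Word → ℕ → Letter
at [] i = Fin.zero
at (a ∷ w) zero = a
at (a ∷ w) (suc i) = at w i

-- The fixed point 𝐮 of φ starting with 0:  𝐮_i = (φ^{i+1}(0))_i
-- (|φ^{i+1}(0)| > i and φ^n(0) is a prefix of φ^{n+1}(0) when t₁ ≥ 1)
𝐮 : ℕ → ℕ → ℕ → Letter
𝐮 t₁ t₂ i = at (uw t₁ t₂ (suc i)) i

prefix : ℕ → ℕ → ℕ → Word
prefix t₁ t₂ ℓ = map (𝐮 t₁ t₂) (upTo ℓ)

factor : Word → ℕ → ℕ → Word
factor w i j = take (j ∸ i) (drop i w)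

IsAttractor : Word → List ℕ → Set
IsAttractor w Γ =
  All (λ γ → γ < length w) Γ ×
  (∀ i j → i < j → j ≤ length w →
     ∃[ i' ] ∃[ j' ] (j' ≤ length w × factor w i' j' ≡ factor w i j ×
        ∃[ γ ] (γ ∈ Γ × i' ≤ γ × γ < j')))

Γ : ℕ → ℕ → ℕ → List ℕ
Γ t₁ t₂ zero = U t₁ t₂ 0 ∸ 1 ∷ []
Γ t₁ t₂ (suc zero) = U t₁ t₂ 0 ∸ 1 ∷ U t₁ t₂ 1 ∸ 1 ∷ []
Γ t₁ t₂ (suc (suc m)) = U t₁ t₂ (suc m) ∸ 1 ∷ U t₁ t₂ (suc (suc m)) ∸ 1 ∷ []

-- Let W k be the periodic sequence u_k^ω, so that W (k + 1) is the φ-image of W k.  Every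
-- factor of W (k + 1) has an occurrence crossing one of the marks U_{k+1} - 1, t₂U_k - 1, and
-- this propagates along φ.  A factor of φ(x) lying inside one image block is 0^m with m ≤ t₁,
-- and such a run also surrounds the image of a marked letter 1 (the two marks carry different
-- letters).  Any other factor of φ(x) is the image of a factor of x followed by at most t₁
-- zeros (image blocks start with t₁ zeros since x has no factor 11), and the image of an
-- occurrence crossing a mark p crosses the last position of φ(x_p), which is again a mark.
--
-- Consecutive W k agree on a prefix of length Z_{k+1}, so a prefix of 𝐮 of length at most
-- Z_{n+1} is a prefix of u_n^ω.  A factor of it is moved into the first period, modulo U_n
-- and then modulo U_{n-1}, unless it crosses U_n - 1 or U_{n-1} - 1 on the way.  Inside the
-- first u_{n-1} it has an occurrence crossing U_{n-1} - 1 or t₂U_{n-2} - 1, and in the latter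
-- case its shift by t₁U_{n-1} crosses U_n - 1 = t₁U_{n-1} + t₂U_{n-2} - 1.

module Submission where

open import Defs
open import Data.Nat using (ℕ; zero; suc; _+_; _*_; _∸_; _⊓_; _≤_; _<_; _≤?_; _<?_; z≤n; s≤s; s≤s⁻¹; NonZero; >-nonZero)
open import Data.Nat.Properties
open import Algebra.Properties.CommutativeSemigroup +-commutativeSemigroup using (x∙yz≈y∙xz; x∙yz≈yx∙z; xy∙z≈xz∙y)
open import Data.Nat.DivMod using (_%_; _/_; m≡m%n+[m/n]*n; m%n<n; m%n≤m; [m+kn]%n≡m%n; [m+n]%n≡m%n; m<n⇒m%n≡m; n%1≡0)
open import Data.Fin using (Fin)
open import Data.List using (List; []; _∷_; _++_; [_]; replicate; concat; length; take; drop; map; applyUpTo; upTo)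
open import Data.List.Properties using (length-++; length-replicate; length-take; length-drop; length-map; length-upTo; concatMap-++; ++-identityʳ)
open import Data.List.Membership.Propositional using (_∈_)
open import Data.List.Relation.Unary.Any using (here; there)
open import Data.List.Relation.Unary.All using (All; []; _∷_)
import Data.List.Relation.Unary.All as All
open import Data.Product using (_×_; _,_; ∃-syntax)
open import Data.Sum using (_⊎_; inj₁; inj₂)
open import Function using (_∘_; id)
open import Relation.Nullary using (yes; no; contradiction)
open import Relation.Binary.PropositionalEquality hiding ([_])
open import Data.Nat.Tactic.RingSolver using (solve-∀)

pattern 𝟘 = Fin.zero
pattern 𝟙 = Fin.suc Fin.zero

one-of-distinct : ∀ {a b : Letter} → a ≢ b → a ≡ 𝟙 ⊎ b ≡ 𝟙
one-of-distinct {𝟙} _ = inj₁ refl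
one-of-distinct {𝟘} {𝟙} _ = inj₂ refl
one-of-distinct {𝟘} {𝟘} a≢b = contradiction refl a≢b

at-++ˡ : ∀ (xs ys : Word) {i} → i < length xs → at (xs ++ ys) i ≡ at xs i
at-++ˡ (x ∷ xs) ys {zero} _ = refl
at-++ˡ (x ∷ xs) ys {suc i} (s≤s i<) = at-++ˡ xs ys i<

at-++ʳ : ∀ (xs ys : Word) i → at (xs ++ ys) (length xs + i) ≡ at ys i
at-++ʳ [] ys i = refl
at-++ʳ (x ∷ xs) ys i = at-++ʳ xs ys i

at-replicate : ∀ n a {i} → i < n → at (replicate n a) i ≡ a
at-replicate (suc n) a {zero} _ = refl
at-replicate (suc n) a {suc i} (s≤s i<n) = at-replicate n a i<n

at-replicate-++ : ∀ n a ys {i} → i < n → at (replicate n a ++ ys) i ≡ a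
at-replicate-++ (suc n) a ys {zero} _ = refl
at-replicate-++ (suc n) a ys {suc i} (s≤s i<n) = at-replicate-++ n a ys i<n

at-replicate-++-length : ∀ n a b ys → at (replicate n a ++ b ∷ ys) n ≡ b
at-replicate-++-length zero a b ys = refl
at-replicate-++-length (suc n) a b ys = at-replicate-++-length n a b ys

at-take : ∀ n (w : Word) {i} → i < n → at (take n w) i ≡ at w i
at-take (suc n) [] _ = refl
at-take (suc n) (x ∷ w) {zero} _ = refl
at-take (suc n) (x ∷ w) {suc i} (s≤s i<n) = at-take n w i<n

at-drop : ∀ n (w : Word) i → at (drop n w) i ≡ at w (n + i)
at-drop zero w i = refl
at-drop (suc n) [] i = refl
at-drop (suc n) (x ∷ w) i = at-drop n w i

at-map-applyUpTo : ∀ (g : ℕ → Letter) f n {i} → i < n → at (map g (applyUpTo f n)) i ≡ g (f i)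
at-map-applyUpTo g f (suc n) {zero} _ = refl
at-map-applyUpTo g f (suc n) {suc i} (s≤s i<n) = at-map-applyUpTo g (f ∘ suc) n i<n

concat-replicate-[] : ∀ n (a : Letter) → concat (replicate n [ a ]) ≡ replicate n a
concat-replicate-[] zero a = refl
concat-replicate-[] (suc n) a = cong (a ∷_) (concat-replicate-[] n a)

length-concat-replicate : ∀ n (w : Word) → length (concat (replicate n w)) ≡ n * length w
length-concat-replicate zero w = refl
length-concat-replicate (suc n) w = trans (length-++ w) (cong (length w +_) (length-concat-replicate n w))

≡-by-at : ∀ (xs ys : Word) → length xs ≡ length ys → (∀ i → i < length xs → at xs i ≡ at ys i) → xs ≡ ys
≡-by-at [] [] _ _ = refl
≡-by-at (x ∷ xs) (y ∷ ys) eq f =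
  cong₂ _∷_ (f 0 (s≤s z≤n)) (≡-by-at xs ys (suc-injective eq) (λ i i< → f (suc i) (s≤s i<)))

length-factor : ∀ (w : Word) a {m} → a + m ≤ length w → length (factor w a (a + m)) ≡ m
length-factor w a {m} a+m≤ = begin
  length (take (a + m ∸ a) (drop a w)) ≡⟨ cong (λ n → length (take n (drop a w))) (m+n∸m≡n a m) ⟩
  length (take m (drop a w))           ≡⟨ length-take m (drop a w) ⟩
  m ⊓ length (drop a w)                ≡⟨ m≤n⇒m⊓n≡m m≤ ⟩
  m                                    ∎
  where
  open ≡-Reasoning
  m≤ : m ≤ length (drop a w)
  m≤ = subst (m ≤_) (sym (length-drop a w)) (subst (_≤ length w ∸ a) (m+n∸m≡n a m) (∸-monoˡ-≤ a a+m≤))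

at-factor : ∀ (w : Word) a {m i} → i < m → at (factor w a (a + m)) i ≡ at w (a + i)
at-factor w a {m} {i} i<m = begin
  at (take (a + m ∸ a) (drop a w)) i ≡⟨ cong (λ n → at (take n (drop a w)) i) (m+n∸m≡n a m) ⟩
  at (take m (drop a w)) i           ≡⟨ at-take m (drop a w) i<m ⟩
  at (drop a w) i                    ≡⟨ at-drop a w i ⟩
  at w (a + i)                       ∎
  where open ≡-Reasoning

<⇒≤∸1 : ∀ {m n} → m < n → m ≤ n ∸ 1
<⇒≤∸1 (s≤s m≤n) = m≤n

≤⇒∸1< : ∀ {n m} → 1 ≤ n → n ≤ m → n ∸ 1 < m
≤⇒∸1< {suc n} _ n<m = n<m

suc-∸1 : ∀ {n} → 1 ≤ n → suc (n ∸ 1) ≡ n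
suc-∸1 {suc n} _ = refl

window : ∀ c {s m} → 1 ≤ s → 1 ≤ m → c + (s ∸ m) ≤ c + (s ∸ 1) × c + (s ∸ 1) < c + (s ∸ m) + m
window c {s} {m} 1≤s 1≤m =
  +-monoʳ-≤ c (∸-monoʳ-≤ s 1≤m) ,
  subst (c + (s ∸ 1) <_) (sym (+-assoc c _ m)) (+-monoʳ-< c (≤⇒∸1< 1≤s (subst (s ≤_) (+-comm m _) (m≤n+m∸n s m))))

last-crossing : ∀ {r n m} → r < n → n ≤ r + m → r ≤ n ∸ 1 × n ∸ 1 < r + m
last-crossing r<n n≤r+m = <⇒≤∸1 r<n , ≤⇒∸1< (≤-trans (s≤s z≤n) r<n) n≤r+m

m∸n+n≤o : ∀ {m n o} → m ≤ o → n ≤ o → m ∸ n + n ≤ o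
m∸n+n≤o {m} {n} {o} m≤o n≤o with n ≤? m
... | yes n≤m = subst (_≤ o) (sym (m∸n+n≡m n≤m)) m≤o
... | no  n≰m = subst (λ k → k + n ≤ o) (sym (m≤n⇒m∸n≡0 (<⇒≤ (≰⇒> n≰m)))) n≤o

Σ< : (ℕ → ℕ) → ℕ → ℕ
Σ< w zero = 0
Σ< w (suc i) = Σ< w i + w i

Σ<-+ : ∀ w a r → Σ< w (a + r) ≡ Σ< w a + Σ< (λ j → w (a + j)) r
Σ<-+ w a zero = trans (cong (Σ< w) (+-identityʳ a)) (sym (+-identityʳ (Σ< w a)))
Σ<-+ w a (suc r) = begin
  Σ< w (a + suc r)                                   ≡⟨ cong (Σ< w) (+-suc a r) ⟩
  Σ< w (a + r) + w (a + r)                           ≡⟨ cong (_+ w (a + r)) (Σ<-+ w a r) ⟩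
  Σ< w a + Σ< (λ j → w (a + j)) r + w (a + r)        ≡⟨ +-assoc (Σ< w a) _ _ ⟩
  Σ< w a + Σ< (λ j → w (a + j)) (suc r)              ∎
  where open ≡-Reasoning

Σ<-cong : ∀ {w w′} L → (∀ i → i < L → w i ≡ w′ i) → Σ< w L ≡ Σ< w′ L
Σ<-cong zero _ = refl
Σ<-cong (suc L) eq = cong₂ _+_ (Σ<-cong L (λ i i<L → eq i (m≤n⇒m≤1+n i<L))) (eq L ≤-refl)

Σ<-mono : ∀ w {i j} → i ≤ j → Σ< w i ≤ Σ< w j
Σ<-mono w {i} i≤j with m≤n⇒∃[o]m+o≡n i≤j
... | o , refl = subst (Σ< w i ≤_) (sym (Σ<-+ w i o)) (m≤m+n (Σ< w i) _)

Σ<-periodic : ∀ w P → (∀ j → w (j + P) ≡ w j) → ∀ i q → Σ< w (i + q * P) ≡ Σ< w i + q * Σ< w P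
Σ<-periodic w P per i zero = trans (cong (Σ< w) (+-identityʳ i)) (sym (+-identityʳ (Σ< w i)))
Σ<-periodic w P per i (suc q) = begin
  Σ< w (i + (P + q * P))                          ≡⟨ cong (Σ< w) (+-comm i (P + q * P)) ⟩
  Σ< w (P + q * P + i)                            ≡⟨ cong (Σ< w) (+-assoc P (q * P) i) ⟩
  Σ< w (P + (q * P + i))                          ≡⟨ Σ<-+ w P (q * P + i) ⟩
  Σ< w P + Σ< (λ j → w (P + j)) (q * P + i)       ≡⟨ cong (Σ< w P +_) (Σ<-cong (q * P + i) (λ j _ → trans (cong w (+-comm P j)) (per j))) ⟩
  Σ< w P + Σ< w (q * P + i)                       ≡⟨ cong (λ n → Σ< w P + Σ< w n) (+-comm (q * P) i) ⟩
  Σ< w P + Σ< w (i + q * P)                       ≡⟨ cong (Σ< w P +_) (Σ<-periodic w P per i q) ⟩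
  Σ< w P + (Σ< w i + q * Σ< w P)                  ≡⟨ x∙yz≈y∙xz (Σ< w P) (Σ< w i) _ ⟩
  Σ< w i + (Σ< w P + q * Σ< w P)                  ∎
  where open ≡-Reasoning

record Located (w : ℕ → ℕ) (P : ℕ) : Set where
  constructor located
  field
    block offset : ℕ
    offset<      : offset < w block
    position     : P ≡ Σ< w block + offset

locate : ∀ w L P → P < Σ< w L → Located w P
locate w (suc L) P P< with P <? Σ< w L
... | yes P<L = locate w L P P<L
... | no  P≮L = located L (P ∸ Σ< w L)
  (subst (P ∸ Σ< w L <_) (m+n∸m≡n (Σ< w L) (w L)) (∸-monoˡ-< P< (≮⇒≥ P≮L)))
  (sym (m+[n∸m]≡n (≮⇒≥ P≮L)))

located-block< : ∀ {w P L} (l : Located w P) → P < Σ< w L → Located.block l < L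
located-block< {w} {L = L} (located i o _ refl) P<ΣL with i <? L
... | yes i<L = i<L
... | no  i≮L = contradiction (≤-trans (Σ<-mono w (≮⇒≥ i≮L)) (m≤m+n (Σ< w i) o)) (<⇒≱ P<ΣL)

locate-positive : ∀ w → (∀ i → 1 ≤ w i) → ∀ P → Located w P
locate-positive w pos P = locate w (suc P) P (Σ<-≥ (suc P))
  where
  Σ<-≥ : ∀ i → i ≤ Σ< w i
  Σ<-≥ zero = z≤n
  Σ<-≥ (suc i) = subst (_≤ Σ< w i + w i) (+-comm i 1) (+-mono-≤ (Σ<-≥ i) (pos i))

Seq : Set
Seq = ℕ → Letter

record Match (x : Seq) (a : ℕ) (z : Seq) (b : ℕ) (n : ℕ) : Set where
  constructor matching
  field letter : ∀ t → t < n → x (a + t) ≡ z (b + t)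

open Match

𝟘ω : Seq
𝟘ω _ = 𝟘

-- Indexing 𝟘ω at a rather than 0 lets Match-inner and Match-++ act on Zeros directly.
Zeros : Seq → ℕ → ℕ → Set
Zeros x a n = Match x a 𝟘ω a n

Crosses : (ℕ → Set) → ℕ → ℕ → Set
Crosses M a m = ∃[ p ] (M p × a ≤ p × p < a + m)

IsAttractorω : Seq → (ℕ → Set) → Set
IsAttractorω x M = ∀ i m → 1 ≤ m → ∃[ a ] (Match x a x i m × Crosses M a m)

Match-refl : ∀ {x a n} → Match x a x a n
Match-refl = matching λ _ _ → refl

Match-sym : ∀ {x a z b n} → Match x a z b n → Match z b x a n
Match-sym eq = matching λ t t<n → sym (letter eq t t<n)

Match-trans : ∀ {x a y b z c n} → Match x a y b n → Match y b z c n → Match x a z c n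
Match-trans eq eq′ = matching λ t t<n → trans (letter eq t t<n) (letter eq′ t t<n)

Match-zeros : ∀ {x a z b n} → Zeros x a n → Zeros z b n → Match x a z b n
Match-zeros zx zz = matching λ t t<n → trans (letter zx t t<n) (sym (letter zz t t<n))

Match-≤ : ∀ {x a z b n m} → m ≤ n → Match x a z b n → Match x a z b m
Match-≤ m≤n eq = matching λ t t<m → letter eq t (<-≤-trans t<m m≤n)

Match-inner : ∀ {x a z b n} o {m} → o + m ≤ n → Match x a z b n → Match x (a + o) z (b + o) m
Match-inner {x} {a} {z} {b} o o+m≤n eq = matching λ t t<m →
  subst₂ (λ i j → x i ≡ z j) (sym (+-assoc a o t)) (sym (+-assoc b o t))
    (letter eq (o + t) (<-≤-trans (+-monoʳ-< o t<m) o+m≤n))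

Match-++ : ∀ {x a z b n k} → Match x a z b n → Match x (a + n) z (b + n) k → Match x a z b (n + k)
Match-++ {x} {a} {z} {b} {n} {k} eq eq′ = matching pointwise
  where
  pointwise : ∀ t → t < n + k → x (a + t) ≡ z (b + t)
  pointwise t t<n+k with t <? n
  ... | yes t<n = letter eq t t<n
  ... | no  t≮n = subst₂ (λ i j → x i ≡ z j) (shift a) (shift b)
                    (letter eq′ (t ∸ n) (+-cancelˡ-< n _ _ (subst (_< n + k) (sym (m+[n∸m]≡n (≮⇒≥ t≮n))) t<n+k)))
    where
    shift : ∀ c → c + n + (t ∸ n) ≡ c + t
    shift c = trans (+-assoc c n (t ∸ n)) (cong (c +_) (m+[n∸m]≡n (≮⇒≥ t≮n)))

IsAttractorω-map : ∀ {x} {M M′ : ℕ → Set} → (∀ {p} → M p → M′ p) → IsAttractorω x M → IsAttractorω x M′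
IsAttractorω-map M⊆M′ att i m 1≤m with att i m 1≤m
... | a , a≈i , p , Mp , a≤p , p<a+m = a , a≈i , p , M⊆M′ Mp , a≤p , p<a+m

Occurs : Seq → ℕ → List ℕ → ℕ → ℕ → Set
Occurs s ℓ Γ i m = ∃[ a ] (a + m ≤ ℓ × Match s a s i m × Crosses (_∈ Γ) a m)

Occurs-≤ : ∀ {s ℓ ℓ′ Γ i m} → ℓ ≤ ℓ′ → Occurs s ℓ Γ i m → Occurs s ℓ′ Γ i m
Occurs-≤ ℓ≤ℓ′ (a , a+m≤ℓ , a≈i , crossing) = a , ≤-trans a+m≤ℓ ℓ≤ℓ′ , a≈i , crossing

Occurs-Match : ∀ {s ℓ Γ a i m} → Match s a s i m → Occurs s ℓ Γ a m → Occurs s ℓ Γ i m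
Occurs-Match a≈i (b , b+m≤ℓ , b≈a , crossing) = b , b+m≤ℓ , Match-trans b≈a a≈i , crossing

module _ (s : Seq) (ℓ : ℕ) where

  length-prefix : length (map s (upTo ℓ)) ≡ ℓ
  length-prefix = trans (length-map s (upTo ℓ)) (length-upTo ℓ)

  at-prefix : ∀ {i} → i < ℓ → at (map s (upTo ℓ)) i ≡ s i
  at-prefix = at-map-applyUpTo s id ℓ

  factor-prefix-Match : ∀ {a i m} → a + m ≤ ℓ → i + m ≤ ℓ → Match s a s i m →
                        factor (map s (upTo ℓ)) a (a + m) ≡ factor (map s (upTo ℓ)) i (i + m)
  factor-prefix-Match {a} {i} {m} a+m≤ℓ i+m≤ℓ a≈i =
    ≡-by-at _ _ (trans (length-factor w a (fits a a+m≤ℓ)) (sym (length-factor w i (fits i i+m≤ℓ)))) pointwise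
    where
    w = map s (upTo ℓ)
    fits : ∀ b → b + m ≤ ℓ → b + m ≤ length w
    fits b = subst (b + m ≤_) (sym length-prefix)
    letter-of : ∀ b {t} → b + m ≤ ℓ → t < m → at (factor w b (b + m)) t ≡ s (b + t)
    letter-of b b+m≤ℓ t<m = trans (at-factor w b t<m) (at-prefix (<-≤-trans (+-monoʳ-< b t<m) b+m≤ℓ))
    pointwise : ∀ t → t < length (factor w a (a + m)) → at (factor w a (a + m)) t ≡ at (factor w i (i + m)) t
    pointwise t t<len = trans (letter-of a a+m≤ℓ t<m) (trans (letter a≈i t t<m) (sym (letter-of i i+m≤ℓ t<m)))
      where
      t<m : t < m
      t<m = subst (t <_) (length-factor w a (fits a a+m≤ℓ)) t<len

  attractor-of-prefix : ∀ Γ → All (_< ℓ) Γ → (∀ i m → 1 ≤ m → i + m ≤ ℓ → Occurs s ℓ Γ i m) →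
                        IsAttractor (map s (upTo ℓ)) Γ
  attractor-of-prefix Γ Γ<ℓ occurs = All.map (subst (_ <_) (sym length-prefix)) Γ<ℓ , factor-crosses
    where
    w = map s (upTo ℓ)
    factor-crosses : ∀ i j → i < j → j ≤ length w →
                     ∃[ i′ ] ∃[ j′ ] (j′ ≤ length w × factor w i′ j′ ≡ factor w i j × ∃[ γ ] (γ ∈ Γ × i′ ≤ γ × γ < j′))
    factor-crosses i j i<j j≤len =
      let a , a+m≤ℓ , a≈i , crossing = occurs i (j ∸ i) (m<n⇒0<n∸m i<j) i+m≤ℓ
      in a , a + (j ∸ i) , subst (a + (j ∸ i) ≤_) (sym length-prefix) a+m≤ℓ ,
         trans (factor-prefix-Match a+m≤ℓ i+m≤ℓ a≈i) (cong (factor w i) i+m≡j) , crossing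
      where
      i+m≡j : i + (j ∸ i) ≡ j
      i+m≡j = m+[n∸m]≡n (<⇒≤ i<j)
      i+m≤ℓ : i + (j ∸ i) ≤ ℓ
      i+m≤ℓ = subst (_≤ ℓ) (sym i+m≡j) (subst (j ≤_) length-prefix j≤len)

cycle : (w : Word) → .{{NonZero (length w)}} → Seq
cycle w i = at w (i % length w)

module _ (w : Word) .{{_ : NonZero (length w)}} where

  cycle-below : ∀ {i} → i < length w → cycle w i ≡ at w i
  cycle-below i<n = cong (at w) (m<n⇒m%n≡m i<n)

  cycle-periodic : ∀ i q → cycle w (i + q * length w) ≡ cycle w i
  cycle-periodic i q = cong (at w) ([m+kn]%n≡m%n i q (length w))

  cycle-Match-% : ∀ i m → Match (cycle w) (i % length w) (cycle w) i m
  cycle-Match-% i m = matching λ t _ → begin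
    cycle w (i % n + t)                 ≡⟨ cycle-periodic (i % n + t) (i / n) ⟨
    cycle w (i % n + t + (i / n) * n)   ≡⟨ cong (cycle w) (xy∙z≈xz∙y (i % n) t _) ⟩
    cycle w (i % n + (i / n) * n + t)   ≡⟨ cong (λ j → cycle w (j + t)) (m≡m%n+[m/n]*n i n) ⟨
    cycle w (i + t)                     ∎
    where
    open ≡-Reasoning
    n = length w

module Substitution (t₁ t₂ : ℕ) where

  φL : Letter → Word
  φL = φ-letter t₁ t₂

  len : Letter → ℕ
  len 𝟘 = suc t₁
  len 𝟙 = t₂

  length-φL : ∀ a → length (φL a) ≡ len a
  length-φL 𝟘 = trans (length-++ (replicate t₁ 𝟘)) (trans (cong (_+ 1) (length-replicate t₁)) (+-comm t₁ 1))
  length-φL 𝟙 = length-replicate t₂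

  swap : Letter → Letter
  swap 𝟘 = 𝟙
  swap 𝟙 = 𝟘

  swap-injective : ∀ {a b} → swap a ≡ swap b → a ≡ b
  swap-injective {𝟘} {𝟘} _ = refl
  swap-injective {𝟙} {𝟙} _ = refl
  swap-injective {𝟘} {𝟙} ()
  swap-injective {𝟙} {𝟘} ()

  φL-zeros : ∀ a {t} → t < t₁ → t < len a → at (φL a) t ≡ 𝟘
  φL-zeros 𝟘 t<t₁ _ = at-replicate-++ t₁ 𝟘 [ 𝟙 ] t<t₁
  φL-zeros 𝟙 _ t<t₂ = at-replicate t₂ 𝟘 t<t₂

  φL-one : ∀ a {t} → t < len a → at (φL a) t ≡ 𝟙 → suc t ≡ len a
  φL-one 𝟘 {t} t≤t₁ one with t <? t₁
  ... | yes t<t₁ = contradiction (trans (sym (φL-zeros 𝟘 t<t₁ t≤t₁)) one) λ ()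
  ... | no  t≮t₁ = cong suc (≤-antisym (≤-pred t≤t₁) (≮⇒≥ t≮t₁))
  φL-one 𝟙 t<t₂ one = contradiction (trans (sym (at-replicate t₂ 𝟘 t<t₂)) one) λ ()

  blockStart : Seq → ℕ → ℕ
  blockStart x = Σ< (λ i → len (x i))

  span : Seq → ℕ → ℕ → ℕ
  span x a = Σ< (λ j → len (x (a + j)))

  record IsImage (x y : Seq) : Set where
    constructor image
    field at-block : ∀ i t → t < len (x i) → y (blockStart x i + t) ≡ at (φL (x i)) t

  open IsImage public

  No11 : Seq → Set
  No11 x = ∀ i → x i ≡ 𝟙 → x (suc i) ≡ 𝟘

  span-cong : ∀ {x a z b} L → Match x a z b L → span x a L ≡ span z b L
  span-cong L eq = Σ<-cong L (λ j j<L → cong len (letter eq j j<L))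

  blockStart-+ : ∀ x a r → blockStart x (a + r) ≡ blockStart x a + span x a r
  blockStart-+ x = Σ<-+ (λ i → len (x i))

  blockStart-∷ : ∀ c w r → blockStart (at (c ∷ w)) (suc r) ≡ len c + blockStart (at w) r
  blockStart-∷ c w r = Σ<-+ (λ i → len (at (c ∷ w) i)) 1 r

  φ-at : ∀ w {r t} → r < length w → t < len (at w r) → at (φ t₁ t₂ w) (blockStart (at w) r + t) ≡ at (φL (at w r)) t
  φ-at (c ∷ w) {zero} _ t< = at-++ˡ (φL c) (φ t₁ t₂ w) (subst (_ <_) (sym (length-φL c)) t<)
  φ-at (c ∷ w) {suc r} {t} (s≤s r<) t< = begin
    at (φL c ++ φ t₁ t₂ w) (blockStart (at (c ∷ w)) (suc r) + t) ≡⟨ cong (λ i → at (φL c ++ φ t₁ t₂ w) (i + t)) (blockStart-∷ c w r) ⟩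
    at (φL c ++ φ t₁ t₂ w) (len c + blockStart (at w) r + t)     ≡⟨ cong (at (φL c ++ φ t₁ t₂ w)) shift ⟩
    at (φL c ++ φ t₁ t₂ w) (length (φL c) + (blockStart (at w) r + t)) ≡⟨ at-++ʳ (φL c) (φ t₁ t₂ w) _ ⟩
    at (φ t₁ t₂ w) (blockStart (at w) r + t)                     ≡⟨ φ-at w r< t< ⟩
    at (φL (at w r)) t                                       ∎
    where
    open ≡-Reasoning
    shift : len c + blockStart (at w) r + t ≡ length (φL c) + (blockStart (at w) r + t)
    shift = trans (+-assoc (len c) _ t) (cong (_+ (blockStart (at w) r + t)) (sym (length-φL c)))

  length-φ : ∀ w → length (φ t₁ t₂ w) ≡ blockStart (at w) (length w)
  length-φ [] = refl
  length-φ (c ∷ w) = begin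
    length (φL c ++ φ t₁ t₂ w)                ≡⟨ length-++ (φL c) ⟩
    length (φL c) + length (φ t₁ t₂ w)        ≡⟨ cong₂ _+_ (length-φL c) (length-φ w) ⟩
    len c + blockStart (at w) (length w)           ≡⟨ blockStart-∷ c w (length w) ⟨
    blockStart (at (c ∷ w)) (suc (length w))       ∎
    where open ≡-Reasoning

  φ-at-< : ∀ w {r t} → r < length w → t < len (at w r) → blockStart (at w) r + t < length (φ t₁ t₂ w)
  φ-at-< w {r} {t} r<n t<len = begin-strict
    blockStart (at w) r + t            <⟨ +-monoʳ-< (blockStart (at w) r) t<len ⟩
    blockStart (at w) (suc r)          ≤⟨ Σ<-mono _ r<n ⟩
    blockStart (at w) (length w)       ≡⟨ length-φ w ⟨
    length (φ t₁ t₂ w)                 ∎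
    where open ≤-Reasoning

  module _ (w : Word) .{{_ : NonZero (length w)}} .{{_ : NonZero (length (φ t₁ t₂ w))}} where

    blockStart-cycle-below : ∀ {j} → j ≤ length w → blockStart (cycle w) j ≡ blockStart (at w) j
    blockStart-cycle-below {j} j≤n = Σ<-cong j (λ i i<j → cong len (cycle-below w (<-≤-trans i<j j≤n)))

    blockStart-cycle : ∀ i q → blockStart (cycle w) (i + q * length w) ≡ blockStart (cycle w) i + q * length (φ t₁ t₂ w)
    blockStart-cycle i q = begin
      blockStart (cycle w) (i + q * length w)                 ≡⟨ Σ<-periodic _ (length w) (λ j → cong (len ∘ at w) ([m+n]%n≡m%n j (length w))) i q ⟩
      blockStart (cycle w) i + q * blockStart (cycle w) (length w) ≡⟨ cong (λ n → blockStart (cycle w) i + q * n) (trans (blockStart-cycle-below ≤-refl) (sym (length-φ w))) ⟩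
      blockStart (cycle w) i + q * length (φ t₁ t₂ w)         ∎
      where open ≡-Reasoning

    cycle-at-block : ∀ i t → t < len (cycle w i) → cycle (φ t₁ t₂ w) (blockStart (cycle w) i + t) ≡ at (φL (cycle w i)) t
    cycle-at-block i t t<len = begin
      cycle φw (blockStart (cycle w) i + t)                ≡⟨ cong (λ j → cycle φw (blockStart (cycle w) j + t)) (m≡m%n+[m/n]*n i n) ⟩
      cycle φw (blockStart (cycle w) (r + q * n) + t)      ≡⟨ cong (λ j → cycle φw (j + t)) (blockStart-cycle r q) ⟩
      cycle φw (blockStart (cycle w) r + q * n′ + t)       ≡⟨ cong (cycle φw) (xy∙z≈xz∙y (blockStart (cycle w) r) (q * n′) t) ⟩
      cycle φw (blockStart (cycle w) r + t + q * n′)       ≡⟨ cycle-periodic φw _ q ⟩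
      cycle φw (blockStart (cycle w) r + t)                ≡⟨ cong (λ j → cycle φw (j + t)) (blockStart-cycle-below (<⇒≤ r<n)) ⟩
      cycle φw (blockStart (at w) r + t)                   ≡⟨ cycle-below φw (φ-at-< w r<n t<len) ⟩
      at φw (blockStart (at w) r + t)                      ≡⟨ φ-at w r<n t<len ⟩
      at (φL (cycle w i)) t                           ∎
      where
      open ≡-Reasoning
      φw = φ t₁ t₂ w
      n = length w
      n′ = length φw
      r = i % n
      q = i / n
      r<n : r < n
      r<n = m%n<n i n

    cycle-image : IsImage (cycle w) (cycle (φ t₁ t₂ w))
    cycle-image = image cycle-at-block

  φ-++ : ∀ v w → φ t₁ t₂ (v ++ w) ≡ φ t₁ t₂ v ++ φ t₁ t₂ w
  φ-++ = concatMap-++ φL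

  φ-concat-replicate : ∀ n w → φ t₁ t₂ (concat (replicate n w)) ≡ concat (replicate n (φ t₁ t₂ w))
  φ-concat-replicate zero w = refl
  φ-concat-replicate (suc n) w = trans (φ-++ w _) (cong (φ t₁ t₂ w ++_) (φ-concat-replicate n w))

  u : ℕ → Word
  u = uw t₁ t₂

  u₁≡ : u 1 ≡ concat (replicate t₁ (u 0)) ++ [ 𝟙 ]
  u₁≡ = trans (++-identityʳ (φL 𝟘)) (cong (_++ [ 𝟙 ]) (sym (concat-replicate-[] t₁ 𝟘)))

  u-rec : ∀ k → u (2 + k) ≡ concat (replicate t₁ (u (1 + k))) ++ concat (replicate t₂ (u k))
  u-rec zero = begin
    φ t₁ t₂ (u 1)                                          ≡⟨ cong (φ t₁ t₂) u₁≡ ⟩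
    φ t₁ t₂ (concat (replicate t₁ (u 0)) ++ [ 𝟙 ])        ≡⟨ φ-++ (concat (replicate t₁ (u 0))) [ 𝟙 ] ⟩
    φ t₁ t₂ (concat (replicate t₁ (u 0))) ++ φL 𝟙 ++ []   ≡⟨ cong₂ _++_ (φ-concat-replicate t₁ (u 0)) φ-𝟙 ⟩
    concat (replicate t₁ (u 1)) ++ concat (replicate t₂ (u 0)) ∎
    where
    open ≡-Reasoning
    φ-𝟙 : φL 𝟙 ++ [] ≡ concat (replicate t₂ (u 0))
    φ-𝟙 = trans (++-identityʳ (φL 𝟙)) (sym (concat-replicate-[] t₂ 𝟘))
  u-rec (suc k) = begin
    φ t₁ t₂ (u (2 + k))                                                              ≡⟨ cong (φ t₁ t₂) (u-rec k) ⟩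
    φ t₁ t₂ (concat (replicate t₁ (u (1 + k))) ++ concat (replicate t₂ (u k)))       ≡⟨ φ-++ (concat (replicate t₁ (u (1 + k)))) _ ⟩
    φ t₁ t₂ (concat (replicate t₁ (u (1 + k)))) ++ φ t₁ t₂ (concat (replicate t₂ (u k)))
      ≡⟨ cong₂ _++_ (φ-concat-replicate t₁ (u (1 + k))) (φ-concat-replicate t₂ (u k)) ⟩
    concat (replicate t₁ (u (2 + k))) ++ concat (replicate t₂ (u (1 + k)))           ∎
    where open ≡-Reasoning

  ∣u∣ : ℕ → ℕ
  ∣u∣ = U t₁ t₂

  ∣u₁∣≡ : ∣u∣ 1 ≡ suc t₁
  ∣u₁∣≡ = begin
    length (u 1)                                  ≡⟨ cong length u₁≡ ⟩
    length (concat (replicate t₁ (u 0)) ++ [ 𝟙 ]) ≡⟨ length-++ (concat (replicate t₁ (u 0))) ⟩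
    length (concat (replicate t₁ (u 0))) + 1      ≡⟨ cong (_+ 1) (trans (length-concat-replicate t₁ (u 0)) (*-identityʳ t₁)) ⟩
    t₁ + 1                                        ≡⟨ +-comm t₁ 1 ⟩
    suc t₁                                        ∎
    where open ≡-Reasoning

  ∣u∣-rec : ∀ k → ∣u∣ (2 + k) ≡ t₁ * ∣u∣ (1 + k) + t₂ * ∣u∣ k
  ∣u∣-rec k = begin
    length (u (2 + k))                                                              ≡⟨ cong length (u-rec k) ⟩
    length (concat (replicate t₁ (u (1 + k))) ++ concat (replicate t₂ (u k)))       ≡⟨ length-++ (concat (replicate t₁ (u (1 + k)))) ⟩
    length (concat (replicate t₁ (u (1 + k)))) + length (concat (replicate t₂ (u k)))
      ≡⟨ cong₂ _+_ (length-concat-replicate t₁ (u (1 + k))) (length-concat-replicate t₂ (u k)) ⟩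
    t₁ * ∣u∣ (1 + k) + t₂ * ∣u∣ k                                           ∎
    where open ≡-Reasoning

  length-Z : ∀ k → Z t₁ t₂ (2 + k) ≡ ∣u∣ (2 + k) + ((t₁ ∸ t₂) * ∣u∣ k + t₂ * length (uw⁻ t₁ t₂ k))
  length-Z k = begin
    length (u (2 + k) ++ concat (replicate (t₁ ∸ t₂) (u k)) ++ concat (replicate t₂ (uw⁻ t₁ t₂ k)))
      ≡⟨ length-++ (u (2 + k)) ⟩
    ∣u∣ (2 + k) + length (concat (replicate (t₁ ∸ t₂) (u k)) ++ concat (replicate t₂ (uw⁻ t₁ t₂ k)))
      ≡⟨ cong (∣u∣ (2 + k) +_) (length-++ (concat (replicate (t₁ ∸ t₂) (u k)))) ⟩
    ∣u∣ (2 + k) + (length (concat (replicate (t₁ ∸ t₂) (u k))) + length (concat (replicate t₂ (uw⁻ t₁ t₂ k))))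
      ≡⟨ cong (∣u∣ (2 + k) +_) (cong₂ _+_ (length-concat-replicate (t₁ ∸ t₂) (u k)) (length-concat-replicate t₂ (uw⁻ t₁ t₂ k))) ⟩
    ∣u∣ (2 + k) + ((t₁ ∸ t₂) * ∣u∣ k + t₂ * length (uw⁻ t₁ t₂ k)) ∎
    where open ≡-Reasoning

module Parry {t₁ t₂ : ℕ} (1≤t₂ : 1 ≤ t₂) (t₂≤t₁ : t₂ ≤ t₁) where

  open Substitution t₁ t₂

  1≤t₁ : 1 ≤ t₁
  1≤t₁ = ≤-trans 1≤t₂ t₂≤t₁

  1≤len : ∀ a → 1 ≤ len a
  1≤len 𝟘 = s≤s z≤n
  1≤len 𝟙 = 1≤t₂

  len≤ : ∀ a → len a ≤ suc t₁
  len≤ 𝟘 = ≤-refl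
  len≤ 𝟙 = m≤n⇒m≤1+n t₂≤t₁

  φL-last : ∀ a → at (φL a) (len a ∸ 1) ≡ swap a
  φL-last 𝟘 = at-replicate-++-length t₁ 𝟘 𝟙 []
  φL-last 𝟙 = at-replicate t₂ 𝟘 (≤⇒∸1< 1≤t₂ ≤-refl)

  1≤∣u∣ : ∀ k → 1 ≤ ∣u∣ k
  1≤∣u∣ zero = ≤-refl
  1≤∣u∣ (suc zero) = subst (1 ≤_) (sym ∣u₁∣≡) (s≤s z≤n)
  1≤∣u∣ (suc (suc k)) = subst (1 ≤_) (sym (∣u∣-rec k)) (≤-trans (*-mono-≤ 1≤t₂ (1≤∣u∣ k)) (m≤n+m _ _))

  t₂∣u∣<∣u∣ : ∀ k → t₂ * ∣u∣ k < ∣u∣ (suc k)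
  t₂∣u∣<∣u∣ zero = subst₂ _<_ (sym (*-identityʳ t₂)) (sym ∣u₁∣≡) (s≤s t₂≤t₁)
  t₂∣u∣<∣u∣ (suc k) = begin-strict
    t₂ * ∣u∣ (suc k)                        ≤⟨ *-monoˡ-≤ (∣u∣ (suc k)) t₂≤t₁ ⟩
    t₁ * ∣u∣ (suc k)                        <⟨ m<m+n _ (*-mono-≤ 1≤t₂ (1≤∣u∣ k)) ⟩
    t₁ * ∣u∣ (suc k) + t₂ * ∣u∣ k           ≡⟨ ∣u∣-rec k ⟨
    ∣u∣ (2 + k)                             ∎
    where open ≤-Reasoning

  ∣u∣<∣u∣ : ∀ k → ∣u∣ k < ∣u∣ (suc k)
  ∣u∣<∣u∣ k = ≤-<-trans (subst (_≤ t₂ * ∣u∣ k) (*-identityˡ (∣u∣ k)) (*-monoˡ-≤ (∣u∣ k) 1≤t₂)) (t₂∣u∣<∣u∣ k)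

  k<∣u∣ : ∀ k → k < ∣u∣ k
  k<∣u∣ zero = ≤-refl
  k<∣u∣ (suc k) = <-≤-trans (s≤s (k<∣u∣ k)) (∣u∣<∣u∣ k)

  ∣u∣-nonZero : ∀ k → NonZero (length (u k))
  ∣u∣-nonZero k = >-nonZero (1≤∣u∣ k)

  W : ℕ → Seq
  W k = cycle (u k) {{∣u∣-nonZero k}}

  W-below : ∀ k {i} → i < ∣u∣ k → W k i ≡ at (u k) i
  W-below k = cycle-below (u k) {{∣u∣-nonZero k}}

  W-periodic : ∀ k i q → W k (i + q * ∣u∣ k) ≡ W k i
  W-periodic k = cycle-periodic (u k) {{∣u∣-nonZero k}}

  _%u_ : ℕ → ℕ → ℕ
  i %u k = _%_ i (∣u∣ k) {{∣u∣-nonZero k}}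

  %u< : ∀ i k → i %u k < ∣u∣ k
  %u< i k = m%n<n i (∣u∣ k) {{∣u∣-nonZero k}}

  %u≤ : ∀ i k → i %u k ≤ i
  %u≤ i k = m%n≤m i (∣u∣ k) {{∣u∣-nonZero k}}

  W-Match-%u : ∀ k i m → Match (W k) (i %u k) (W k) i m
  W-Match-%u k = cycle-Match-% (u k) {{∣u∣-nonZero k}}

  W-shift : ∀ k q {a m} → Match (W k) (q * ∣u∣ k + a) (W k) a m
  W-shift k q {a} = matching λ t _ → trans (cong (W k) (trans (+-assoc (q * ∣u∣ k) a t) (+-comm (q * ∣u∣ k) (a + t)))) (W-periodic k (a + t) q)

  W-image : ∀ k → IsImage (W k) (W (suc k))
  W-image k = cycle-image (u k) {{∣u∣-nonZero k}} {{∣u∣-nonZero (suc k)}}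

  blockStart-W : ∀ k i q → blockStart (W k) (i + q * ∣u∣ k) ≡ blockStart (W k) i + q * ∣u∣ (suc k)
  blockStart-W k = blockStart-cycle (u k) {{∣u∣-nonZero k}} {{∣u∣-nonZero (suc k)}}

  -- Factors of images

  lastOfBlock : Seq → ℕ → ℕ
  lastOfBlock x p = blockStart x p + (len (x p) ∸ 1)

  suc-lastOfBlock : ∀ x p → suc (lastOfBlock x p) ≡ blockStart x (suc p)
  suc-lastOfBlock x p = trans (sym (+-suc _ _)) (cong (blockStart x p +_) (suc-∸1 (1≤len (x p))))

  lastOfBlock-∸1 : ∀ x {n n′} → 1 ≤ n → blockStart x n ≡ n′ → lastOfBlock x (n ∸ 1) ≡ n′ ∸ 1
  lastOfBlock-∸1 x 1≤n eq = cong (_∸ 1) (trans (suc-lastOfBlock x _) (trans (cong (blockStart x) (suc-∸1 1≤n)) eq))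

  lastOfBlock-inside : ∀ x {a L p o m} → a ≤ p → p < a + L → o < len (x a) → span x a L ≤ o + m →
                       blockStart x a + o ≤ lastOfBlock x p × lastOfBlock x p < blockStart x a + o + m
  lastOfBlock-inside x {a} {L} {p} {o} {m} a≤p p<a+L o<len span≤o+m = s≤s⁻¹ lower , upper
    where
    lower : suc (blockStart x a + o) ≤ suc (lastOfBlock x p)
    lower = begin
      suc (blockStart x a + o)      ≤⟨ +-monoʳ-< (blockStart x a) o<len ⟩
      blockStart x (suc a)          ≤⟨ Σ<-mono _ (s≤s a≤p) ⟩
      blockStart x (suc p)          ≡⟨ suc-lastOfBlock x p ⟨
      suc (lastOfBlock x p)         ∎
      where open ≤-Reasoning
    upper : lastOfBlock x p < blockStart x a + o + m
    upper = begin-strict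
      lastOfBlock x p               <⟨ ≤-reflexive (suc-lastOfBlock x p) ⟩
      blockStart x (suc p)          ≤⟨ Σ<-mono _ p<a+L ⟩
      blockStart x (a + L)          ≡⟨ blockStart-+ x a L ⟩
      blockStart x a + span x a L   ≤⟨ +-monoʳ-≤ (blockStart x a) span≤o+m ⟩
      blockStart x a + (o + m)      ≡⟨ +-assoc (blockStart x a) o m ⟨
      blockStart x a + o + m        ∎
      where open ≤-Reasoning

  locateImage : ∀ (x : Seq) P → Located (λ i → len (x i)) P
  locateImage x = locate-positive (λ i → len (x i)) (λ i → 1≤len (x i))

  module _ {x y} (x↦y : IsImage x y) where

    image-last : ∀ p → y (lastOfBlock x p) ≡ swap (x p)
    image-last p = trans (at-block x↦y p _ (≤⇒∸1< (1≤len (x p)) ≤-refl)) (φL-last (x p))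

    image-No11 : No11 y
    image-No11 P yP≡𝟙 with locateImage x P
    ... | located i o o< refl = begin
      y (suc (blockStart x i + o))         ≡⟨ cong y (sym (+-suc _ o)) ⟩
      y (blockStart x i + suc o)           ≡⟨ cong (λ n → y (blockStart x i + n)) (φL-one (x i) o< (trans (sym (at-block x↦y i o o<)) yP≡𝟙)) ⟩
      y (blockStart x (suc i))             ≡⟨ cong y (+-identityʳ _) ⟨
      y (blockStart x (suc i) + 0)         ≡⟨ at-block x↦y (suc i) 0 (1≤len (x (suc i))) ⟩
      at (φL (x (suc i))) 0                ≡⟨ φL-zeros (x (suc i)) 1≤t₁ (1≤len (x (suc i))) ⟩
      𝟘                                    ∎
      where open ≡-Reasoning

    image-block-zeros : ∀ q {n} → n ≤ t₁ → n ≤ len (x q) → Zeros y (blockStart x q) n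
    image-block-zeros q n≤t₁ n≤len = matching λ t t<n →
      trans (at-block x↦y q t (<-≤-trans t<n n≤len)) (φL-zeros (x q) (<-≤-trans t<n n≤t₁) (<-≤-trans t<n n≤len))

    module _ (x-No11 : No11 x) where

      image-zeros-after-𝟙 : ∀ q → x q ≡ 𝟙 → Zeros y (blockStart x q) (t₂ + t₁)
      image-zeros-after-𝟙 q xq≡𝟙 = Match-++
        (image-block-zeros q t₂≤t₁ (subst (λ a → t₂ ≤ len a) (sym xq≡𝟙) ≤-refl))
        (subst (λ i → Zeros y i t₁) next-block (image-block-zeros (suc q) ≤-refl (subst (λ a → t₁ ≤ len a) (sym (x-No11 q xq≡𝟙)) (n≤1+n t₁))))
        where
        next-block : blockStart x (suc q) ≡ blockStart x q + t₂
        next-block = cong (λ a → blockStart x q + len a) xq≡𝟙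

      image-zeros : ∀ q → Zeros y (blockStart x q) t₁
      image-zeros q with x q in xq
      ... | 𝟘 = image-block-zeros q ≤-refl (subst (λ a → t₁ ≤ len a) (sym xq) (n≤1+n t₁))
      ... | 𝟙 = Match-≤ (m≤n+m t₁ t₂) (image-zeros-after-𝟙 q xq)

  image-Match : ∀ {x y z w a b L} → IsImage x y → IsImage z w → Match x a z b L →
                Match y (blockStart x a) w (blockStart z b) (span z b L)
  image-Match {x} {y} {z} {w} {a} {b} {L} x↦y z↦w eq = matching pointwise
    where
    pointwise : ∀ d → d < span z b L → y (blockStart x a + d) ≡ w (blockStart z b + d)
    pointwise d d<span with locate (λ j → len (z (b + j))) L d d<span
                          | located-block< {L = L} (locate (λ j → len (z (b + j))) L d d<span) d<span
    ... | located r o o< refl | r<L = begin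
      y (blockStart x a + (span z b r + o))   ≡⟨ cong (λ n → y (blockStart x a + (n + o))) (span-cong r (Match-≤ (<⇒≤ r<L) eq)) ⟨
      y (blockStart x a + (span x a r + o))   ≡⟨ cong y (inner-position x a) ⟩
      y (blockStart x (a + r) + o)            ≡⟨ at-block x↦y (a + r) o (subst (λ c → o < len c) (sym (letter eq r r<L)) o<) ⟩
      at (φL (x (a + r))) o                   ≡⟨ cong (λ c → at (φL c) o) (letter eq r r<L) ⟩
      at (φL (z (b + r))) o                   ≡⟨ at-block z↦w (b + r) o o< ⟨
      w (blockStart z (b + r) + o)            ≡⟨ cong w (inner-position z b) ⟨
      w (blockStart z b + (span z b r + o))   ∎
      where
      open ≡-Reasoning
      inner-position : ∀ v c → blockStart v c + (span v c r + o) ≡ blockStart v (c + r) + o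
      inner-position v c = trans (sym (+-assoc (blockStart v c) (span v c r) o)) (cong (_+ o) (sym (blockStart-+ v c r)))

  image-Match-zeros : ∀ {x y z w a b L} → IsImage x y → IsImage z w → No11 x → No11 z → Match x a z b L →
                      Match y (blockStart x a) w (blockStart z b) (span z b L + t₁)
  image-Match-zeros {x} {y} {z} {w} {a} {b} {L} x↦y z↦w x-No11 z-No11 eq =
    Match-++ (image-Match x↦y z↦w eq)
      (Match-zeros (subst (λ i → Zeros y i t₁) x-end (image-zeros x↦y x-No11 (a + L)))
                   (subst (λ i → Zeros w i t₁) (blockStart-+ z b L) (image-zeros z↦w z-No11 (b + L))))
    where
    x-end : blockStart x (a + L) ≡ blockStart x a + span z b L
    x-end = trans (blockStart-+ x a L) (cong (blockStart x a +_) (span-cong L eq))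

  ImageMark : Seq → (ℕ → Set) → ℕ → Set
  ImageMark x M P = ∃[ p ] (M p × P ≡ lastOfBlock x p)

  module _ {x y} {M : ℕ → Set} (x↦y : IsImage x y) (x-No11 : No11 x) where

    zeros-cross-mark : ∀ {p I m} → M p → x p ≡ 𝟙 → 1 ≤ m → m ≤ t₁ → Zeros y I m →
                       ∃[ a ] (Match y a y I m × Crosses (ImageMark x M) a m)
    zeros-cross-mark {p} {I} {m} Mp xp≡𝟙 1≤m m≤t₁ zeros-I =
      c + (t₂ ∸ m) , Match-zeros (Match-inner (t₂ ∸ m) fits (image-zeros-after-𝟙 x↦y x-No11 p xp≡𝟙)) zeros-I ,
      c + (t₂ ∸ 1) , (p , Mp , last≡) , window c 1≤t₂ 1≤m
      where
      c = blockStart x p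
      fits : t₂ ∸ m + m ≤ t₂ + t₁
      fits = +-mono-≤ (m∸n≤m t₂ m) m≤t₁
      last≡ : c + (t₂ ∸ 1) ≡ lastOfBlock x p
      last≡ = cong (λ a → c + (len a ∸ 1)) (sym xp≡𝟙)

    module _ (att : IsAttractorω x M) where

      factor-in-block : ∀ {p a o b j m} → M p → x p ≡ 𝟙 → 1 ≤ m → j < len (x b) → b ≤ a →
                        blockStart x a + o + m ≡ blockStart x b + j →
                        ∃[ a′ ] (Match y a′ y (blockStart x a + o) m × Crosses (ImageMark x M) a′ m)
      factor-in-block {a = a} {o} {b} {j} {m} Mp xp≡𝟙 1≤m j<len b≤a end =
        zeros-cross-mark Mp xp≡𝟙 1≤m (≤-trans (m≤n+m m o) o+m≤t₁) (Match-inner o o+m≤t₁ (image-zeros x↦y x-No11 a))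
        where
        o+m≤j : o + m ≤ j
        o+m≤j = +-cancelˡ-≤ (blockStart x a) _ _ (begin
          blockStart x a + (o + m)   ≡⟨ +-assoc (blockStart x a) o m ⟨
          blockStart x a + o + m     ≡⟨ end ⟩
          blockStart x b + j         ≤⟨ +-monoˡ-≤ j (Σ<-mono _ b≤a) ⟩
          blockStart x a + j         ∎)
          where open ≤-Reasoning
        o+m≤t₁ : o + m ≤ t₁
        o+m≤t₁ = ≤-trans o+m≤j (s≤s⁻¹ (≤-trans j<len (len≤ (x b))))

      factor-across-blocks : ∀ {a o b j m} → o < len (x a) → a < b →
                             blockStart x a + o + m ≡ blockStart x b + j → j < len (x b) →
                             ∃[ a′ ] (Match y a′ y (blockStart x a + o) m × Crosses (ImageMark x M) a′ m)
      factor-across-blocks {a} {o} {b} {j} {m} o<len a<b end j<len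
        with att a (b ∸ a) (m<n⇒0<n∸m a<b)
      ... | a′ , x-match , p , Mp , a′≤p , p<a′+L =
        blockStart x a′ + o ,
        Match-inner o o+m≤D+t₁ (image-Match-zeros x↦y x↦y x-No11 x-No11 x-match) ,
        lastOfBlock x p , (p , Mp , refl) ,
        lastOfBlock-inside x a′≤p p<a′+L (subst (λ c → o < len c) (sym x-a′≡x-a) o<len) span≤o+m
        where
        L = b ∸ a
        D = span x a L
        j≤t₁ : j ≤ t₁
        j≤t₁ = s≤s⁻¹ (≤-trans j<len (len≤ (x b)))
        o+m≡D+j : o + m ≡ D + j
        o+m≡D+j = +-cancelˡ-≡ (blockStart x a) _ _ (begin
          blockStart x a + (o + m)   ≡⟨ +-assoc (blockStart x a) o m ⟨
          blockStart x a + o + m     ≡⟨ end ⟩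
          blockStart x b + j         ≡⟨ cong (λ i → blockStart x i + j) (m+[n∸m]≡n (<⇒≤ a<b)) ⟨
          blockStart x (a + L) + j   ≡⟨ cong (_+ j) (blockStart-+ x a L) ⟩
          blockStart x a + D + j     ≡⟨ +-assoc (blockStart x a) D j ⟩
          blockStart x a + (D + j)   ∎)
          where open ≡-Reasoning
        o+m≤D+t₁ : o + m ≤ D + t₁
        o+m≤D+t₁ = subst (_≤ D + t₁) (sym o+m≡D+j) (+-monoʳ-≤ D j≤t₁)
        x-a′≡x-a : x a′ ≡ x a
        x-a′≡x-a = subst₂ (λ i k → x i ≡ x k) (+-identityʳ a′) (+-identityʳ a) (letter x-match 0 (m<n⇒0<n∸m a<b))
        span≤o+m : span x a′ L ≤ o + m
        span≤o+m = subst₂ _≤_ (sym (span-cong L x-match)) (sym o+m≡D+j) (m≤m+n D j)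

      attractor-image : ∃[ p ] (M p × x p ≡ 𝟙) → IsAttractorω y (ImageMark x M)
      attractor-image (p , Mp , xp≡𝟙) I m 1≤m with locateImage x I | locateImage x (I + m)
      ... | located a o o<len refl | located b j j<len end with a <? b
      ...   | yes a<b = factor-across-blocks o<len a<b end j<len
      ...   | no  a≮b = factor-in-block Mp xp≡𝟙 1≤m j<len (≮⇒≥ a≮b) end

  -- Agreement of consecutive u_k^ω and of 𝐮

  W₀≡𝟘 : ∀ i → W 0 i ≡ 𝟘
  W₀≡𝟘 i = cong (at [ 𝟘 ]) (n%1≡0 i)

  W-No11 : ∀ k → No11 (W k)
  W-No11 zero i W₀i≡𝟙 = contradiction (trans (sym (W₀≡𝟘 i)) W₀i≡𝟙) λ ()
  W-No11 (suc k) = image-No11 (W-image k)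

  W₁-below : ∀ {i} → i < suc t₁ → W 1 i ≡ at (φL 𝟘) i
  W₁-below i<len = trans (W-below 1 (subst (_ <_) (sym ∣u₁∣≡) i<len))
                         (at-++ˡ (φL 𝟘) [] (subst (_ <_) (sym (length-φL 𝟘)) i<len))

  W₁-zeros : Zeros (W 1) 0 t₁
  W₁-zeros = matching λ t t<t₁ → trans (W₁-below (m≤n⇒m≤1+n t<t₁)) (φL-zeros 𝟘 t<t₁ (m≤n⇒m≤1+n t<t₁))

  W₁-last : W 1 t₁ ≡ 𝟙
  W₁-last = trans (W₁-below ≤-refl) (φL-last 𝟘)

  -- A common prefix length of u_{k+1}^ω and u_k^ω (W-agree); Λ (suc k) is Z_{k+2} (Z≡Λ).
  Λ : ℕ → ℕ
  Λ zero = t₁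
  Λ (suc zero) = t₁ * ∣u∣ 1 + t₁
  Λ (suc (suc k)) = suc t₁ * ∣u∣ (2 + k)

  blockStart-W₀ : blockStart (W 0) t₁ ≡ t₁ * ∣u∣ 1
  blockStart-W₀ = trans (cong (blockStart (W 0)) (sym (*-identityʳ t₁))) (blockStart-W 0 0 t₁)

  blockStart-W₁ : blockStart (W 1) t₁ + t₂ ≡ ∣u∣ 2
  blockStart-W₁ = begin
    blockStart (W 1) t₁ + t₂          ≡⟨ cong (λ a → blockStart (W 1) t₁ + len a) W₁-last ⟨
    blockStart (W 1) (suc t₁)         ≡⟨ cong (blockStart (W 1)) (trans (sym ∣u₁∣≡) (sym (*-identityˡ (∣u∣ 1)))) ⟩
    blockStart (W 1) (1 * ∣u∣ 1)      ≡⟨ blockStart-W 1 0 1 ⟩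
    1 * ∣u∣ 2                         ≡⟨ *-identityˡ (∣u∣ 2) ⟩
    ∣u∣ 2                             ∎
    where open ≡-Reasoning

  Λ-growth : ∀ k → Λ (suc k) ≤ blockStart (W k) (Λ k) + t₁
  Λ-growth zero = ≤-reflexive (cong (_+ t₁) (sym blockStart-W₀))
  Λ-growth (suc zero) = begin
    ∣u∣ 2 + t₁ * ∣u∣ 2                               ≡⟨ +-comm (∣u∣ 2) (t₁ * ∣u∣ 2) ⟩
    t₁ * ∣u∣ 2 + ∣u∣ 2                               ≡⟨ cong (t₁ * ∣u∣ 2 +_) blockStart-W₁ ⟨
    t₁ * ∣u∣ 2 + (blockStart (W 1) t₁ + t₂)          ≤⟨ +-monoʳ-≤ (t₁ * ∣u∣ 2) (+-monoʳ-≤ (blockStart (W 1) t₁) t₂≤t₁) ⟩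
    t₁ * ∣u∣ 2 + (blockStart (W 1) t₁ + t₁)          ≡⟨ x∙yz≈yx∙z (t₁ * ∣u∣ 2) (blockStart (W 1) t₁) t₁ ⟩
    blockStart (W 1) t₁ + t₁ * ∣u∣ 2 + t₁            ≡⟨ cong (_+ t₁) (blockStart-W 1 t₁ t₁) ⟨
    blockStart (W 1) (t₁ + t₁ * ∣u∣ 1) + t₁          ≡⟨ cong (λ n → blockStart (W 1) n + t₁) (+-comm t₁ (t₁ * ∣u∣ 1)) ⟩
    blockStart (W 1) (t₁ * ∣u∣ 1 + t₁) + t₁          ∎
    where open ≤-Reasoning
  Λ-growth (suc (suc k)) = ≤-trans (≤-reflexive (sym (blockStart-W (2 + k) 0 (suc t₁)))) (m≤m+n _ t₁)

  W-agree : ∀ k → Match (W (suc k)) 0 (W k) 0 (Λ k)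
  W-agree zero = Match-zeros W₁-zeros (matching λ t _ → W₀≡𝟘 t)
  W-agree (suc k) = Match-≤ (Λ-growth k) (image-Match-zeros (W-image (suc k)) (W-image k) (W-No11 (suc k)) (W-No11 k) (W-agree k))

  t₁∣u∣≤Λ : ∀ k → t₁ * ∣u∣ k ≤ Λ k
  t₁∣u∣≤Λ zero = ≤-reflexive (*-identityʳ t₁)
  t₁∣u∣≤Λ (suc zero) = m≤m+n _ t₁
  t₁∣u∣≤Λ (suc (suc k)) = m≤n+m _ (∣u∣ (2 + k))

  Λ-below : ∀ k → Λ (suc k) ≤ suc t₁ * ∣u∣ (suc k)
  Λ-below zero = begin
    t₁ * ∣u∣ 1 + t₁      ≤⟨ +-monoʳ-≤ (t₁ * ∣u∣ 1) (subst (t₁ ≤_) (sym ∣u₁∣≡) (n≤1+n t₁)) ⟩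
    t₁ * ∣u∣ 1 + ∣u∣ 1   ≡⟨ +-comm (t₁ * ∣u∣ 1) (∣u∣ 1) ⟩
    suc t₁ * ∣u∣ 1       ∎
    where open ≤-Reasoning
  Λ-below (suc k) = ≤-refl

  Λ-above : ∀ k → suc t₁ * ∣u∣ (suc k) ≤ suc (Λ (suc k))
  Λ-above zero = ≤-reflexive (begin
    ∣u∣ 1 + t₁ * ∣u∣ 1       ≡⟨ +-comm (∣u∣ 1) (t₁ * ∣u∣ 1) ⟩
    t₁ * ∣u∣ 1 + ∣u∣ 1       ≡⟨ cong (t₁ * ∣u∣ 1 +_) ∣u₁∣≡ ⟩
    t₁ * ∣u∣ 1 + suc t₁      ≡⟨ +-suc (t₁ * ∣u∣ 1) t₁ ⟩
    suc (t₁ * ∣u∣ 1 + t₁)    ∎)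
    where open ≡-Reasoning
  Λ-above (suc k) = n≤1+n _

  ∣u∣≤Λ : ∀ k → ∣u∣ (suc k) ≤ Λ (suc k)
  ∣u∣≤Λ zero = subst (_≤ Λ 1) (sym ∣u₁∣≡) (+-monoˡ-≤ t₁ (*-mono-≤ 1≤t₁ (1≤∣u∣ 1)))
  ∣u∣≤Λ (suc k) = m≤m+n (∣u∣ (2 + k)) _

  ∣u₂∣≤Λ₁ : ∣u∣ 2 ≤ Λ 1
  ∣u₂∣≤Λ₁ = subst (_≤ Λ 1) (sym (∣u∣-rec 0)) (+-monoʳ-≤ (t₁ * ∣u∣ 1) (subst (_≤ t₁) (sym (*-identityʳ t₂)) t₂≤t₁))

  Λ≤∣u∣ : ∀ k → Λ (suc k) ≤ ∣u∣ (3 + k)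
  Λ≤∣u∣ k = begin
    Λ (suc k)                                ≤⟨ Λ-below k ⟩
    ∣u∣ (suc k) + t₁ * ∣u∣ (suc k)           ≤⟨ +-mono-≤ (subst (_≤ t₂ * ∣u∣ (suc k)) (*-identityˡ _) (*-monoˡ-≤ _ 1≤t₂))
                                                          (*-monoʳ-≤ t₁ (<⇒≤ (∣u∣<∣u∣ (suc k)))) ⟩
    t₂ * ∣u∣ (suc k) + t₁ * ∣u∣ (2 + k)      ≡⟨ +-comm (t₂ * ∣u∣ (suc k)) (t₁ * ∣u∣ (2 + k)) ⟩
    t₁ * ∣u∣ (2 + k) + t₂ * ∣u∣ (suc k)      ≡⟨ ∣u∣-rec (suc k) ⟨
    ∣u∣ (3 + k)                              ∎
    where open ≤-Reasoning

  ∣u∣≤Λ-previous : ∀ k → ∣u∣ (3 + k) ≤ Λ (2 + k)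
  ∣u∣≤Λ-previous k = begin
    ∣u∣ (3 + k)                              ≡⟨ ∣u∣-rec (suc k) ⟩
    t₁ * ∣u∣ (2 + k) + t₂ * ∣u∣ (suc k)      ≤⟨ +-monoʳ-≤ (t₁ * ∣u∣ (2 + k)) (<⇒≤ (t₂∣u∣<∣u∣ (suc k))) ⟩
    t₁ * ∣u∣ (2 + k) + ∣u∣ (2 + k)           ≡⟨ +-comm _ (∣u∣ (2 + k)) ⟩
    suc t₁ * ∣u∣ (2 + k)                     ∎
    where open ≤-Reasoning

  Z≡Λ : ∀ k → Z t₁ t₂ (2 + k) ≡ Λ (suc k)
  Z≡Λ zero = begin
    Z t₁ t₂ 2                                           ≡⟨ length-Z 0 ⟩
    ∣u∣ 2 + ((t₁ ∸ t₂) * 1 + t₂ * 0)                   ≡⟨ cong (_+ ((t₁ ∸ t₂) * 1 + t₂ * 0)) (∣u∣-rec 0) ⟩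
    t₁ * ∣u∣ 1 + t₂ * 1 + ((t₁ ∸ t₂) * 1 + t₂ * 0)     ≡⟨ normalise (t₁ * ∣u∣ 1) t₂ (t₁ ∸ t₂) ⟩
    t₁ * ∣u∣ 1 + (t₂ + (t₁ ∸ t₂))                      ≡⟨ cong (t₁ * ∣u∣ 1 +_) (m+[n∸m]≡n t₂≤t₁) ⟩
    t₁ * ∣u∣ 1 + t₁                                     ∎
    where
    open ≡-Reasoning
    normalise : ∀ a b d → a + b * 1 + (d * 1 + b * 0) ≡ a + (b + d)
    normalise = solve-∀
  Z≡Λ (suc k) = begin
    Z t₁ t₂ (3 + k)                                     ≡⟨ length-Z (suc k) ⟩
    ∣u∣ (3 + k) + ((t₁ ∸ t₂) * V + t₂ * C)             ≡⟨ cong (_+ ((t₁ ∸ t₂) * V + t₂ * C)) (∣u∣-rec (suc k)) ⟩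
    t₁ * P + t₂ * V + ((t₁ ∸ t₂) * V + t₂ * C)         ≡⟨ normalise (t₁ * P) t₂ (t₁ ∸ t₂) V (t₂ * C) ⟩
    t₁ * P + ((t₂ + (t₁ ∸ t₂)) * V + t₂ * C)           ≡⟨ cong (λ n → t₁ * P + (n * V + t₂ * C)) (m+[n∸m]≡n t₂≤t₁) ⟩
    t₁ * P + (t₁ * V + t₂ * C)                          ≡⟨ cong (t₁ * P +_) (∣u∣-rec k) ⟨
    t₁ * P + P                                          ≡⟨ +-comm (t₁ * P) P ⟩
    suc t₁ * P                                          ∎
    where
    open ≡-Reasoning
    P = ∣u∣ (2 + k)
    V = ∣u∣ (1 + k)
    C = ∣u∣ k
    normalise : ∀ a b d v c → a + b * v + (d * v + c) ≡ a + ((b + d) * v + c)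
    normalise = solve-∀

  Λ-increasing : ∀ k → Λ (suc k) ≤ Λ (2 + k)
  Λ-increasing k = ≤-trans (Λ-below k) (*-monoʳ-≤ (suc t₁) (<⇒≤ (∣u∣<∣u∣ (suc k))))

  Λ-mono : ∀ j d → Λ (suc j) ≤ Λ (suc (d + j))
  Λ-mono j zero = ≤-refl
  Λ-mono j (suc d) = ≤-trans (Λ-mono j d) (Λ-increasing (d + j))

  W-stable : ∀ j d → Match (W (suc (d + j))) 0 (W (suc j)) 0 (Λ (suc j))
  W-stable j zero = Match-refl
  W-stable j (suc d) = Match-trans (Match-≤ (Λ-mono j d) (W-agree (suc (d + j)))) (W-stable j d)

  W-agree-above : ∀ {i j} → i ≤ j → Match (W (suc j)) 0 (W (suc i)) 0 (Λ (suc i))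
  W-agree-above {i} {j} i≤j =
    subst (λ n → Match (W (suc n)) 0 (W (suc i)) 0 (Λ (suc i))) (m∸n+n≡m i≤j) (W-stable i (j ∸ i))

  𝐮-agree : ∀ j → Match (𝐮 t₁ t₂) 0 (W (suc j)) 0 (Λ (suc j))
  𝐮-agree j = matching λ i i<Λ → trans (𝐮≡W i) (same-level i i<Λ)
    where
    i<∣u∣ : ∀ i → i < ∣u∣ (suc i)
    i<∣u∣ i = <-trans (n<1+n i) (k<∣u∣ (suc i))
    𝐮≡W : ∀ i → 𝐮 t₁ t₂ i ≡ W (suc i) i
    𝐮≡W i = sym (W-below (suc i) (i<∣u∣ i))
    same-level : ∀ i → i < Λ (suc j) → W (suc i) i ≡ W (suc j) i
    same-level i i<Λ with ≤-total i j
    ... | inj₁ i≤j = sym (letter (W-agree-above i≤j) i (<-≤-trans (i<∣u∣ i) (∣u∣≤Λ i)))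
    ... | inj₂ j≤i = letter (W-agree-above j≤i) i i<Λ

  -- Attractors of u_k^ω

  Mark : ℕ → ℕ → Set
  Mark k p = p ≡ ∣u∣ (suc k) ∸ 1 ⊎ p ≡ t₂ * ∣u∣ k ∸ 1

  mark₁-image : ∀ k → lastOfBlock (W (suc k)) (∣u∣ (suc k) ∸ 1) ≡ ∣u∣ (2 + k) ∸ 1
  mark₁-image k = lastOfBlock-∸1 (W (suc k)) (1≤∣u∣ (suc k))
    (trans (cong (blockStart (W (suc k))) (sym (*-identityˡ (∣u∣ (suc k))))) (trans (blockStart-W (suc k) 0 1) (*-identityˡ (∣u∣ (2 + k)))))

  mark₂-image : ∀ k → lastOfBlock (W (suc k)) (t₂ * ∣u∣ k ∸ 1) ≡ t₂ * ∣u∣ (suc k) ∸ 1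
  mark₂-image k = lastOfBlock-∸1 (W (suc k)) (*-mono-≤ 1≤t₂ (1≤∣u∣ k))
    (trans (span-cong (t₂ * ∣u∣ k) (Match-≤ t₂∣u∣≤Λ (W-agree k))) (blockStart-W k 0 t₂))
    where
    t₂∣u∣≤Λ : t₂ * ∣u∣ k ≤ Λ k
    t₂∣u∣≤Λ = ≤-trans (*-monoˡ-≤ (∣u∣ k) t₂≤t₁) (t₁∣u∣≤Λ k)

  Mark-image : ∀ k {P} → ImageMark (W (suc k)) (Mark k) P → Mark (suc k) P
  Mark-image k (p , inj₁ refl , refl) = inj₁ (mark₁-image k)
  Mark-image k (p , inj₂ refl , refl) = inj₂ (mark₂-image k)

  marks-differ : ∀ k → W (suc k) (∣u∣ (suc k) ∸ 1) ≢ W (suc k) (t₂ * ∣u∣ k ∸ 1)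
  marks-differ zero eq = contradiction (trans (sym W₁-last′) (trans eq W₁-zero)) λ ()
    where
    W₁-last′ : W 1 (∣u∣ 1 ∸ 1) ≡ 𝟙
    W₁-last′ = trans (cong (λ n → W 1 (n ∸ 1)) ∣u₁∣≡) W₁-last
    W₁-zero : W 1 (t₂ * 1 ∸ 1) ≡ 𝟘
    W₁-zero = letter W₁-zeros _ (subst (λ n → n ∸ 1 < t₁) (sym (*-identityʳ t₂)) (≤⇒∸1< 1≤t₂ t₂≤t₁))
  marks-differ (suc k) eq = marks-differ k (swap-injective (trans (sym (last-of (mark₁-image k))) (trans eq (last-of (mark₂-image k)))))
    where
    last-of : ∀ {p P} → lastOfBlock (W (suc k)) p ≡ P → W (2 + k) P ≡ swap (W (suc k) p)
    last-of refl = image-last (W-image (suc k)) _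

  marked-𝟙 : ∀ k → ∃[ p ] (Mark k p × W (suc k) p ≡ 𝟙)
  marked-𝟙 k with one-of-distinct (marks-differ k)
  ... | inj₁ W≡𝟙 = _ , inj₁ refl , W≡𝟙
  ... | inj₂ W≡𝟙 = _ , inj₂ refl , W≡𝟙

  W₁-attractor : IsAttractorω (W 1) (Mark 0)
  W₁-attractor i m 1≤m with ∣u∣ 1 ≤? i %u 1 + m
  ... | yes ∣u₁∣≤r+m = i %u 1 , W-Match-%u 1 i m , ∣u∣ 1 ∸ 1 , inj₁ refl , last-crossing (%u< i 1) ∣u₁∣≤r+m
  ... | no  r+m≮∣u₁∣ = t₂ ∸ m , Match-trans zeros≈r (W-Match-%u 1 i m) , t₂ ∸ 1 , inj₂ t₂-mark , window 0 1≤t₂ 1≤m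
    where
    r = i %u 1
    r+m≤t₁ : r + m ≤ t₁
    r+m≤t₁ = s≤s⁻¹ (subst (r + m <_) ∣u₁∣≡ (≰⇒> r+m≮∣u₁∣))
    zeros≈r : Match (W 1) (t₂ ∸ m) (W 1) r m
    zeros≈r = Match-zeros (Match-inner (t₂ ∸ m) (m∸n+n≤o t₂≤t₁ (≤-trans (m≤n+m m r) r+m≤t₁)) W₁-zeros)
                          (Match-inner r r+m≤t₁ W₁-zeros)
    t₂-mark : t₂ ∸ 1 ≡ t₂ * ∣u∣ 0 ∸ 1
    t₂-mark = cong (_∸ 1) (sym (*-identityʳ t₂))

  W-attractor : ∀ k → IsAttractorω (W (suc k)) (Mark k)
  W-attractor zero = W₁-attractor
  W-attractor (suc k) = IsAttractorω-map (Mark-image k)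
    (attractor-image (W-image (suc k)) (W-No11 (suc k)) (W-attractor k) (marked-𝟙 k))

  -- Attractors of prefixes of 𝐮

  𝐮-zeros : Zeros (𝐮 t₁ t₂) 0 t₁
  𝐮-zeros = Match-trans (Match-≤ (m≤n+m t₁ _) (𝐮-agree 0)) W₁-zeros

  W⇒𝐮-Match : ∀ j {a b m} → a + m ≤ Λ (suc j) → b + m ≤ Λ (suc j) →
              Match (W (suc j)) a (W (suc j)) b m → Match (𝐮 t₁ t₂) a (𝐮 t₁ t₂) b m
  W⇒𝐮-Match j {a} {b} a+m≤Λ b+m≤Λ a≈b =
    Match-trans (Match-inner a a+m≤Λ (𝐮-agree j)) (Match-trans a≈b (Match-sym (Match-inner b b+m≤Λ (𝐮-agree j))))

  𝐮-Match-%u : ∀ j {L i m} → L ≤ Λ (suc j) → i + m ≤ L → Match (𝐮 t₁ t₂) (i %u suc j) (𝐮 t₁ t₂) i m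
  𝐮-Match-%u j {i = i} {m} L≤Λ i+m≤L =
    W⇒𝐮-Match j (≤-trans (+-monoˡ-≤ m (%u≤ i (suc j))) i+m≤Λ) i+m≤Λ (W-Match-%u (suc j) i m)
    where
    i+m≤Λ : i + m ≤ Λ (suc j)
    i+m≤Λ = ≤-trans i+m≤L L≤Λ

  reduce-to-first-period : ∀ j {L Γ i m} → L ≤ Λ (suc j) → ∣u∣ (suc j) ∸ 1 ∈ Γ → i + m ≤ L →
                           Occurs (𝐮 t₁ t₂) L Γ i m ⊎ (i %u suc j + m < ∣u∣ (suc j) × Match (𝐮 t₁ t₂) (i %u suc j) (𝐮 t₁ t₂) i m)
  reduce-to-first-period j {i = i} {m} L≤Λ last∈Γ i+m≤L with ∣u∣ (suc j) ≤? i %u suc j + m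
  ... | yes ∣u∣≤r+m = inj₁ (i %u suc j , ≤-trans (+-monoˡ-≤ m (%u≤ i (suc j))) i+m≤L , 𝐮-Match-%u j L≤Λ i+m≤L ,
                           ∣u∣ (suc j) ∸ 1 , last∈Γ , last-crossing (%u< i (suc j)) ∣u∣≤r+m)
  ... | no  r+m≮∣u∣ = inj₂ (≰⇒> r+m≮∣u∣ , 𝐮-Match-%u j L≤Λ i+m≤L)

  occurs-at-0 : ∀ {ℓ Γ i m} → 0 ∈ Γ → 1 ≤ m → m ≤ ℓ → m ≤ t₁ → Zeros (𝐮 t₁ t₂) i m → Occurs (𝐮 t₁ t₂) ℓ Γ i m
  occurs-at-0 0∈Γ 1≤m m≤ℓ m≤t₁ zeros-i = 0 , m≤ℓ , Match-zeros (Match-≤ m≤t₁ 𝐮-zeros) zeros-i , 0 , 0∈Γ , z≤n , 1≤m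

  attractor-Γ₀ : ∀ {ℓ} → 1 ≤ ℓ → ℓ ≤ t₁ → IsAttractor (prefix t₁ t₂ ℓ) (Γ t₁ t₂ 0)
  attractor-Γ₀ {ℓ} 1≤ℓ ℓ≤t₁ = attractor-of-prefix (𝐮 t₁ t₂) ℓ _ (1≤ℓ ∷ []) occurs
    where
    occurs : ∀ i m → 1 ≤ m → i + m ≤ ℓ → Occurs (𝐮 t₁ t₂) ℓ (Γ t₁ t₂ 0) i m
    occurs i m 1≤m i+m≤ℓ =
      occurs-at-0 (here refl) 1≤m (≤-trans (m≤n+m m i) i+m≤ℓ) (≤-trans (m≤n+m m i) i+m≤t₁) (Match-inner i i+m≤t₁ 𝐮-zeros)
      where
      i+m≤t₁ : i + m ≤ t₁
      i+m≤t₁ = ≤-trans i+m≤ℓ ℓ≤t₁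

  attractor-Γ₁ : ∀ {ℓ} → ∣u∣ 1 ≤ ℓ → ℓ ≤ Λ 1 → IsAttractor (prefix t₁ t₂ ℓ) (Γ t₁ t₂ 1)
  attractor-Γ₁ {ℓ} ∣u₁∣≤ℓ ℓ≤Λ = attractor-of-prefix (𝐮 t₁ t₂) ℓ _ (≤-trans (1≤∣u∣ 1) ∣u₁∣≤ℓ ∷ ≤⇒∸1< (1≤∣u∣ 1) ∣u₁∣≤ℓ ∷ []) occurs
    where
    occurs : ∀ i m → 1 ≤ m → i + m ≤ ℓ → Occurs (𝐮 t₁ t₂) ℓ (Γ t₁ t₂ 1) i m
    occurs i m 1≤m i+m≤ℓ with reduce-to-first-period 0 ℓ≤Λ (there (here refl)) i+m≤ℓ
    ... | inj₁ occ = occ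
    ... | inj₂ (r+m<∣u₁∣ , r≈i) =
      Occurs-Match r≈i (occurs-at-0 (here refl) 1≤m (≤-trans (m≤n+m m i) i+m≤ℓ) (≤-trans (m≤n+m m r) r+m≤t₁) (Match-inner r r+m≤t₁ 𝐮-zeros))
      where
      r = i %u 1
      r+m≤t₁ : r + m ≤ t₁
      r+m≤t₁ = s≤s⁻¹ (subst (r + m <_) ∣u₁∣≡ r+m<∣u₁∣)

  module _ (k : ℕ) where

    private
      V = ∣u∣ (suc k)
      P = ∣u∣ (2 + k)
      C = t₂ * ∣u∣ k

    mark< : ∀ {p} → Mark k p → p < V
    mark< (inj₁ refl) = ≤⇒∸1< (1≤∣u∣ (suc k)) ≤-refl
    mark< (inj₂ refl) = ≤-<-trans (m∸n≤m C 1) (t₂∣u∣<∣u∣ k)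

    inner-mark : ∀ {p e} → Mark k p → p < e → e < V → p ≡ C ∸ 1
    inner-mark (inj₁ refl) V∸1<e e<V = contradiction (subst (_≤ _) (suc-∸1 (1≤∣u∣ (suc k))) V∸1<e) (<⇒≱ e<V)
    inner-mark (inj₂ p≡C∸1) _ _ = p≡C∸1

    P∸1≡ : P ∸ 1 ≡ t₁ * V + (C ∸ 1)
    P∸1≡ = trans (cong (_∸ 1) (∣u∣-rec k)) (+-∸-assoc (t₁ * V) (*-mono-≤ 1≤t₂ (1≤∣u∣ k)))

    below-Λ : ∀ {x} → x < suc t₁ * V → x ≤ Λ (suc k)
    below-Λ x< = s≤s⁻¹ (<-≤-trans x< (Λ-above k))

    P≤Λ : P ≤ Λ (suc k)
    P≤Λ = below-Λ (subst₂ _<_ (sym (∣u∣-rec k)) (+-comm (t₁ * V) V) (+-monoʳ-< (t₁ * V) (t₂∣u∣<∣u∣ k)))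

    crosses-V : ∀ {a r m} → a < V → V ≤ a + m → r + m < V → Match (W (suc k)) a (W (suc k)) r m →
                Occurs (𝐮 t₁ t₂) (Λ (suc k)) (Γ t₁ t₂ (2 + k)) r m
    crosses-V {a} {r} {m} a<V V≤a+m r+m<V a≈r =
      a , a+m≤Λ , W⇒𝐮-Match k a+m≤Λ r+m≤Λ a≈r , V ∸ 1 , here refl , last-crossing a<V V≤a+m
      where
      V+V≤ : V + V ≤ suc t₁ * V
      V+V≤ = +-monoʳ-≤ V (subst (_≤ t₁ * V) (*-identityˡ V) (*-monoˡ-≤ V 1≤t₁))
      a+m≤Λ : a + m ≤ Λ (suc k)
      a+m≤Λ = below-Λ (<-≤-trans (+-mono-< a<V (≤-<-trans (m≤n+m m r) r+m<V)) V+V≤)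
      r+m≤Λ : r + m ≤ Λ (suc k)
      r+m≤Λ = ≤-trans (<⇒≤ r+m<V) (∣u∣≤Λ k)

    crosses-P : ∀ {a r m} → a ≤ C ∸ 1 → C ∸ 1 < a + m → a + m < V → r + m < V → Match (W (suc k)) a (W (suc k)) r m →
                Occurs (𝐮 t₁ t₂) (Λ (suc k)) (Γ t₁ t₂ (2 + k)) r m
    crosses-P {a} {r} {m} a≤C∸1 C∸1<a+m a+m<V r+m<V a≈r =
      t₁ * V + a , a′+m≤Λ , W⇒𝐮-Match k a′+m≤Λ r+m≤Λ (Match-trans (W-shift (suc k) t₁) a≈r) ,
      P ∸ 1 , there (here refl) ,
      subst (t₁ * V + a ≤_) (sym P∸1≡) (+-monoʳ-≤ (t₁ * V) a≤C∸1) ,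
      subst₂ _<_ (sym P∸1≡) (sym (+-assoc (t₁ * V) a m)) (+-monoʳ-< (t₁ * V) C∸1<a+m)
      where
      a′+m≤Λ : t₁ * V + a + m ≤ Λ (suc k)
      a′+m≤Λ = below-Λ (subst₂ _<_ (sym (+-assoc (t₁ * V) a m)) (+-comm (t₁ * V) V) (+-monoʳ-< (t₁ * V) a+m<V))
      r+m≤Λ : r + m ≤ Λ (suc k)
      r+m≤Λ = ≤-trans (<⇒≤ r+m<V) (∣u∣≤Λ k)

    occurs-in-first-period : ∀ {r m} → 1 ≤ m → r + m < V → Occurs (𝐮 t₁ t₂) (Λ (suc k)) (Γ t₁ t₂ (2 + k)) r m
    occurs-in-first-period {r} {m} 1≤m r+m<V with W-attractor k r m 1≤m
    ... | a , a≈r , p , Mp , a≤p , p<a+m with V ≤? a + m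
    ...   | yes V≤a+m = crosses-V (≤-<-trans a≤p (mark< Mp)) V≤a+m r+m<V a≈r
    ...   | no  a+m≮V = crosses-P (subst (a ≤_) p≡C∸1 a≤p) (subst (_< a + m) p≡C∸1 p<a+m) (≰⇒> a+m≮V) r+m<V a≈r
      where
      p≡C∸1 : p ≡ C ∸ 1
      p≡C∸1 = inner-mark Mp p<a+m (≰⇒> a+m≮V)

    attractor-Γ : ∀ {ℓ} → Λ (suc k) ≤ ℓ → ℓ ≤ Λ (2 + k) → IsAttractor (prefix t₁ t₂ ℓ) (Γ t₁ t₂ (2 + k))
    attractor-Γ {ℓ} Λ≤ℓ ℓ≤Λ = attractor-of-prefix (𝐮 t₁ t₂) ℓ _
      (≤⇒∸1< (1≤∣u∣ (suc k)) (≤-trans (∣u∣≤Λ k) Λ≤ℓ) ∷ ≤⇒∸1< (1≤∣u∣ (2 + k)) (≤-trans P≤Λ Λ≤ℓ) ∷ []) occurs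
      where
      occurs : ∀ i m → 1 ≤ m → i + m ≤ ℓ → Occurs (𝐮 t₁ t₂) ℓ (Γ t₁ t₂ (2 + k)) i m
      occurs i m 1≤m i+m≤ℓ with reduce-to-first-period (suc k) ℓ≤Λ (there (here refl)) i+m≤ℓ
      ... | inj₁ occ = occ
      ... | inj₂ (r+m<P , r≈i) with reduce-to-first-period k ≤-refl (here refl) (≤-trans (<⇒≤ r+m<P) P≤Λ)
      ...   | inj₁ occ = Occurs-Match r≈i (Occurs-≤ Λ≤ℓ occ)
      ...   | inj₂ (r′+m<V , r′≈r) = Occurs-Match (Match-trans r′≈r r≈i) (Occurs-≤ Λ≤ℓ (occurs-in-first-period 1≤m r′+m<V))

proposition4p16 : (t₁ t₂ : ℕ) → 1 ≤ t₂ → t₂ ≤ t₁ →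
    ((n : ℕ) → n ≤ 1 → (ℓ : ℕ) → U t₁ t₂ n ≤ ℓ → ℓ ≤ U t₁ t₂ (suc n) ∸ 1 →
       IsAttractor (prefix t₁ t₂ ℓ) (Γ t₁ t₂ n))
    × ((n : ℕ) → 2 ≤ n → (ℓ : ℕ) → U t₁ t₂ n ≤ ℓ → ℓ ≤ Z t₁ t₂ n →
       IsAttractor (prefix t₁ t₂ ℓ) (Γ t₁ t₂ (n ∸ 1)))
    × ((n : ℕ) → 2 ≤ n → (ℓ : ℕ) → Z t₁ t₂ n ≤ ℓ → ℓ ≤ U t₁ t₂ (suc n) →
       IsAttractor (prefix t₁ t₂ ℓ) (Γ t₁ t₂ n))
proposition4p16 t₁ t₂ 1≤t₂ t₂≤t₁ = part₁ , part₂ , part₃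
  where
  open Substitution t₁ t₂
  open Parry 1≤t₂ t₂≤t₁
  part₁ : (n : ℕ) → n ≤ 1 → (ℓ : ℕ) → ∣u∣ n ≤ ℓ → ℓ ≤ ∣u∣ (suc n) ∸ 1 → IsAttractor (prefix t₁ t₂ ℓ) (Γ t₁ t₂ n)
  part₁ zero _ ℓ lo hi = attractor-Γ₀ lo (subst (λ n → ℓ ≤ n ∸ 1) ∣u₁∣≡ hi)
  part₁ (suc zero) _ ℓ lo hi = attractor-Γ₁ lo (≤-trans hi (≤-trans (m∸n≤m (∣u∣ 2) 1) ∣u₂∣≤Λ₁))
  part₁ (suc (suc _)) (s≤s ())
  part₂ : (n : ℕ) → 2 ≤ n → (ℓ : ℕ) → ∣u∣ n ≤ ℓ → ℓ ≤ Z t₁ t₂ n → IsAttractor (prefix t₁ t₂ ℓ) (Γ t₁ t₂ (n ∸ 1))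
  part₂ (suc zero) (s≤s ())
  part₂ (suc (suc zero)) _ ℓ lo hi = attractor-Γ₁ (≤-trans (<⇒≤ (∣u∣<∣u∣ 1)) lo) (subst (ℓ ≤_) (Z≡Λ 0) hi)
  part₂ (suc (suc (suc k))) _ ℓ lo hi = attractor-Γ k (≤-trans (Λ≤∣u∣ k) lo) (subst (ℓ ≤_) (Z≡Λ (suc k)) hi)
  part₃ : (n : ℕ) → 2 ≤ n → (ℓ : ℕ) → Z t₁ t₂ n ≤ ℓ → ℓ ≤ ∣u∣ (suc n) → IsAttractor (prefix t₁ t₂ ℓ) (Γ t₁ t₂ n)
  part₃ (suc zero) (s≤s ())
  part₃ (suc (suc k)) _ ℓ lo hi = attractor-Γ k (subst (_≤ ℓ) (Z≡Λ k) lo) (≤-trans hi (∣u∣≤Λ-previous k))
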